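{- For a string $T$ of length $n$, the sum of the lengths of all highly periodic runs in $T$ is $\mathcal{O}(n\log n)$.
   Context: $\textsf{per}(S)$ is the smallest period of $S$. A run in $T$ is a fragment $R=T[a\mathinner{.\,.} b]$ with $\textsf{per}(R)\le|R|/2$ that cannot be extended to the left or to the right without increasing the smallest period (i.e., $T[a-1]\ne T[a+p-1]$ and $T[b-p+1]\ne T[b+1]$ where $p=\textsf{per}(R)$, whenever these positions exist). A run $R$ is highly periodic if $\textsf{per}(R)\le|R|/4$. -}

module Defs where

open import Data.Nat using (ℕ; zero; suc; _+_; _*_; _∸_; _≤_; _<_)
open import Data.Fin using (Fin; toℕ)
open import Data.Product using (Σ; _×_; _,_)
open import Relation.Binary.PropositionalEquality using (_≡_; _≢_)
open import Relation.Nullary using (¬_)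

-- Strings of length n over an alphabet A: T : Fin n → A (0-indexed).
-- A fragment T[a..b] (inclusive) is given by a pair (a , b) with a ≤ b < n.

fragLen : ℕ × ℕ → ℕ
fragLen (a , b) = suc b ∸ a

HasPeriod : {A : Set} {n : ℕ} → (Fin n → A) → ℕ → ℕ → ℕ → Set
HasPeriod {n = n} T a b p =
  (i j : Fin n) → a ≤ toℕ i → toℕ j ≤ b → toℕ j ≡ toℕ i + p → T i ≡ T j

IsPer : {A : Set} {n : ℕ} → (Fin n → A) → ℕ → ℕ → ℕ → Set
IsPer T a b p =
  (1 ≤ p) × HasPeriod T a b p × ((q : ℕ) → 1 ≤ q → q < p → ¬ HasPeriod T a b q)

IsRunWithPer : {A : Set} {n : ℕ} → (Fin n → A) → ℕ → ℕ → ℕ → Set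
IsRunWithPer {n = n} T a b p =
  (a ≤ b) × (b < n) × IsPer T a b p × (2 * p ≤ fragLen (a , b))
  -- cannot be extended to the left: T[a-1] ≠ T[a+p-1] (when a-1 exists)
  × ((i j : Fin n) → suc (toℕ i) ≡ a → toℕ j ≡ toℕ i + p → T i ≢ T j)
  -- cannot be extended to the right: T[b-p+1] ≠ T[b+1] (when b+1 exists)
  × ((i j : Fin n) → toℕ j ≡ suc b → toℕ j ≡ toℕ i + p → T i ≢ T j)

IsRun : {A : Set} {n : ℕ} → (Fin n → A) → ℕ × ℕ → Set
IsRun T (a , b) = Σ ℕ (λ p → IsRunWithPer T a b p)

IsHPRun : {A : Set} {n : ℕ} → (Fin n → A) → ℕ × ℕ → Set
IsHPRun T (a , b) = Σ ℕ (λ p → IsRunWithPer T a b p × (4 * p ≤ fragLen (a , b)))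

module Submission where

-- Let R = T[a..b] be a highly periodic run with period p, so |R| ≥ 4p.  Call
-- the positions x with a + p ≤ x and x + p ≤ b the core of R; it covers at
-- least half of R.  The key geometric fact is the overlap lemma: two runs
-- whose common part contains a window of length at least the sum of their
-- periods are equal.  It follows from period extension (a period d holding on
-- a window of length ≥ q + d inside a fragment with period q holds on the whole
-- fragment) together with minimality of the period and maximality of runs.
-- If two highly periodic runs with periods of the same scale ⌊log₂ p⌋ share a
-- core position, their overlap is that long, so they coincide.  Hence every
-- position lies in at most ⌊log₂ n⌋ + 1 cores (a pigeonhole argument on the
-- scales), and double counting gives Σ |R| ≤ 2 Σ |core R| ≤ 2 n (⌊log₂ n⌋ + 1),
-- which is at most 4 n ⌊log₂ n⌋ for n ≥ 2.

open import Defs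
open import Data.Nat using (ℕ; _*_; _≤_)
open import Data.Nat.Logarithm using (⌊log₂_⌋)
open import Data.Fin using (Fin)
open import Data.Product using (_×_; ∃-syntax)
open import Data.List using (List; map)
open import Data.Nat.ListAction using (sum)
open import Data.List.Membership.Propositional using (_∈_)
open import Data.List.Relation.Unary.Unique.Propositional using (Unique)

open import Data.Nat using (zero; suc; _+_; _∸_; _<_; _<?_; _≤?_; z≤n; s≤s; s≤s⁻¹)
open import Data.Nat.Properties
open import Data.Nat.Induction using (<-rec)
open import Data.Nat.Tactic.RingSolver using (solve-∀)
open import Data.Nat.Logarithm using (⌊log₂⌋-mono-≤; ⌊log₂[2*b]⌋≡1+⌊log₂b⌋; ⌊log₂[2^n]⌋≡n)
open import Data.Fin using (toℕ; fromℕ<)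
open import Data.Fin.Properties using (toℕ<n; toℕ-fromℕ<; fromℕ<-toℕ; pigeonhole) renaming (<⇒≢ to <⇒≢ᶠ)
open import Data.Maybe using (Maybe; just; nothing)
open import Data.Maybe.Properties using (just-injective)
open import Data.Product using (Σ; _,_; proj₁)
open import Data.Sum using (inj₁; inj₂)
open import Data.Empty using (⊥; ⊥-elim)
open import Data.List using ([]; _∷_; length; filter; lookup)
open import Data.List.Properties using (length-map; map-∘)
open import Data.List.Membership.Propositional.Properties using (∈-lookup)
open import Data.List.Relation.Unary.All as All using (All; []; _∷_)
import Data.List.Relation.Unary.All.Properties as Allₚ
open import Data.List.Relation.Unary.AllPairs as AllPairs using (AllPairs; []; _∷_)
import Data.List.Relation.Unary.AllPairs.Properties as AllPairsₚ
open import Function using (_∘_)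
open import Relation.Binary using (tri<; tri≈; tri>)
open import Relation.Binary.PropositionalEquality
open import Relation.Nullary using (¬_; Dec; yes; no; contradiction)
open import Relation.Nullary.Decidable using (_×-dec_)
open import Relation.Unary using (Decidable)

+-right-comm : ∀ x y z → x + y + z ≡ x + z + y
+-right-comm = solve-∀

window-reach : ∀ {a b c e p q} → a ≤ c → e ≤ b → c + p + q ≤ suc e → a + p ≤ suc b
window-reach {c = c} {p = p} {q} a≤c e≤b wide =
  ≤-trans (+-monoˡ-≤ p a≤c) (≤-trans (m≤m+n (c + p) q) (≤-trans wide (s≤s e≤b)))

same-scale-close : ∀ {p q} → 1 ≤ p → ⌊log₂ p ⌋ ≡ ⌊log₂ q ⌋ → q < 2 * p
same-scale-close {suc p} {q} _ same with q <? 2 * suc p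
... | yes q<2p = q<2p
... | no  q≮2p = contradiction (begin
    suc ⌊log₂ suc p ⌋    ≡⟨ sym (⌊log₂[2*b]⌋≡1+⌊log₂b⌋ (suc p)) ⟩
    ⌊log₂ (2 * suc p) ⌋  ≤⟨ ⌊log₂⌋-mono-≤ (≮⇒≥ q≮2p) ⟩
    ⌊log₂ q ⌋            ≡⟨ sym same ⟩
    ⌊log₂ suc p ⌋        ∎) 1+n≰n
  where open ≤-Reasoning

n-log-n-bound : ∀ n → 2 ≤ n → 2 * (n * suc ⌊log₂ n ⌋) ≤ 4 * n * ⌊log₂ n ⌋
n-log-n-bound n 2≤n = absorb-one n ⌊log₂ n ⌋ (subst (_≤ ⌊log₂ n ⌋) (⌊log₂[2^n]⌋≡n 1) (⌊log₂⌋-mono-≤ 2≤n))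
  where
    absorb-one : ∀ n K → 1 ≤ K → 2 * (n * suc K) ≤ 4 * n * K
    absorb-one n (suc K) _ = subst (2 * (n * suc (suc K)) ≤_) (sym (split n K)) (m≤m+n _ _)
      where
        split : ∀ n K → 4 * n * suc K ≡ 2 * (n * suc (suc K)) + 2 * n * K
        split = solve-∀

sumBelow : ℕ → (ℕ → ℕ) → ℕ
sumBelow zero    f = 0
sumBelow (suc m) f = sumBelow m f + f m

sumBelow-mono : ∀ m {f g} → (∀ x → f x ≤ g x) → sumBelow m f ≤ sumBelow m g
sumBelow-mono zero    f≤g = z≤n
sumBelow-mono (suc m) f≤g = +-mono-≤ (sumBelow-mono m f≤g) (f≤g m)

sumBelow-cong : ∀ m {f g} → (∀ x → f x ≡ g x) → sumBelow m f ≡ sumBelow m g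
sumBelow-cong zero    f≡g = refl
sumBelow-cong (suc m) f≡g = cong₂ _+_ (sumBelow-cong m f≡g) (f≡g m)

sumBelow-const : ∀ m c → sumBelow m (λ _ → c) ≡ m * c
sumBelow-const zero    c = refl
sumBelow-const (suc m) c = trans (cong (_+ c) (sumBelow-const m c)) (+-comm (m * c) c)

sumBelow-+ : ∀ m f g → sumBelow m (λ x → f x + g x) ≡ sumBelow m f + sumBelow m g
sumBelow-+ zero    f g = refl
sumBelow-+ (suc m) f g =
  trans (cong (_+ (f m + g m)) (sumBelow-+ m f g)) (+-+-interchange (sumBelow m f) (sumBelow m g) (f m) (g m))
  where
    +-+-interchange : ∀ w x y z → w + x + (y + z) ≡ w + y + (x + z)
    +-+-interchange = solve-∀

sumBelow-ones : ∀ m lo t {f} → lo + t ≤ m → (∀ u → u < t → 1 ≤ f (lo + u)) → t ≤ sumBelow m f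
sumBelow-ones zero    lo t       lo+t≤0   _    = ≤-trans (m≤n+m t lo) lo+t≤0
sumBelow-ones (suc m) lo zero    _        _    = z≤n
sumBelow-ones (suc m) lo (suc t) {f} lo+t<m+1 ones with lo + suc t ≤? m
... | yes lo+t≤m = ≤-trans (sumBelow-ones m lo (suc t) lo+t≤m ones) (m≤m+n _ _)
-- otherwise the last marked position lo + t - 1 is m itself
... | no  lo+t≰m = subst (_≤ sumBelow m f + f m) (+-comm t 1)
        (+-mono-≤ (sumBelow-ones m lo t lo+t'≤m (λ u u<t → ones u (m<n⇒m<1+n u<t)))
                  (subst (λ x → 1 ≤ f x) lo+t'≡m (ones t ≤-refl)))
  where
    lo+t'≤m : lo + t ≤ m
    lo+t'≤m = s≤s⁻¹ (subst (_≤ suc m) (+-suc lo t) lo+t<m+1)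
    lo+t'≡m : lo + t ≡ m
    lo+t'≡m = ≤-antisym lo+t'≤m (s≤s⁻¹ (subst (suc m ≤_) (+-suc lo t) (≰⇒> lo+t≰m)))

indicator : ∀ {P : Set} → Dec P → ℕ
indicator (yes _) = 1
indicator (no _)  = 0

indicator-yes : ∀ {P : Set} (P? : Dec P) → P → 1 ≤ indicator P?
indicator-yes (yes _) _ = ≤-refl
indicator-yes (no ¬p) p = contradiction p ¬p

module _ {X : Set} where

  sum-map-mono : (xs : List X) {f g : X → ℕ} → (∀ x → f x ≤ g x) → sum (map f xs) ≤ sum (map g xs)
  sum-map-mono []       f≤g = z≤n
  sum-map-mono (x ∷ xs) f≤g = +-mono-≤ (f≤g x) (sum-map-mono xs f≤g)

  sum-map-scale : (xs : List X) (k : ℕ) (f : X → ℕ) → sum (map (λ x → k * f x) xs) ≡ k * sum (map f xs)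
  sum-map-scale []       k f = sym (*-zeroʳ k)
  sum-map-scale (x ∷ xs) k f =
    trans (cong (k * f x +_) (sum-map-scale xs k f)) (sym (*-distribˡ-+ k (f x) (sum (map f xs))))

  length-filter-∷ : ∀ {P : X → Set} (P? : Decidable P) x xs →
                    length (filter P? (x ∷ xs)) ≡ indicator (P? x) + length (filter P? xs)
  length-filter-∷ P? x xs with P? x
  ... | yes _ = refl
  ... | no  _ = refl

  double-counting : ∀ {P : ℕ → X → Set} (P? : ∀ x → Decidable (P x)) m (xs : List X) →
                    sum (map (λ I → sumBelow m (λ x → indicator (P? x I))) xs)
                      ≡ sumBelow m (λ x → length (filter (P? x) xs))
  double-counting P? m [] = sym (trans (sumBelow-const m 0) (*-zeroʳ m))
  double-counting P? m (I ∷ xs) = begin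
      sumBelow m (λ x → indicator (P? x I)) + sum (map (λ J → sumBelow m (λ x → indicator (P? x J))) xs)
        ≡⟨ cong (sumBelow m (λ x → indicator (P? x I)) +_) (double-counting P? m xs) ⟩
      sumBelow m (λ x → indicator (P? x I)) + sumBelow m (λ x → length (filter (P? x) xs))
        ≡⟨ sym (sumBelow-+ m _ _) ⟩
      sumBelow m (λ x → indicator (P? x I) + length (filter (P? x) xs))
        ≡⟨ sumBelow-cong m (λ x → sym (length-filter-∷ (P? x) I xs)) ⟩
      sumBelow m (λ x → length (filter (P? x) (I ∷ xs)))  ∎
    where open ≡-Reasoning

  lookup-injective : ∀ {xs : List X} → Unique xs → ∀ i j → lookup xs i ≡ lookup xs j → i ≡ j
  lookup-injective (_     ∷ _)    Fin.zero    Fin.zero    _  = refl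
  lookup-injective (x∉xs ∷ _)    Fin.zero    (Fin.suc j) eq = contradiction eq (All.lookup x∉xs (∈-lookup j))
  lookup-injective (x∉xs ∷ _)    (Fin.suc i) Fin.zero    eq = contradiction (sym eq) (All.lookup x∉xs (∈-lookup i))
  lookup-injective (_     ∷ uniq) (Fin.suc i) (Fin.suc j) eq = cong Fin.suc (lookup-injective uniq i j eq)

  discharge : ∀ {P : X → Set} {R : X → X → Set} {xs : List X} → All P xs →
              AllPairs (λ x y → P x → P y → R x y) xs → AllPairs R xs
  discharge []         []         = []
  discharge (px ∷ pxs) (rx ∷ rxs) = All.zipWith (λ (py , r) → r px py) (pxs , rx) ∷ discharge pxs rxs

unique-bounded : ∀ {m} {xs : List ℕ} → Unique xs → All (_< m) xs → length xs ≤ m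
unique-bounded {m} {xs} uniq bounded with m <? length xs
... | no  m≮len = ≮⇒≥ m≮len
... | yes m<len with pigeonhole m<len (λ i → fromℕ< (All.lookup bounded (∈-lookup i)))
...   | i , j , i<j , same = contradiction (lookup-injective uniq i j lookups-equal) (<⇒≢ᶠ i<j)
  where
    lookups-equal : lookup xs i ≡ lookup xs j
    lookups-equal = trans (sym (toℕ-fromℕ< _)) (trans (cong toℕ same) (toℕ-fromℕ< _))

filter-keys-bound : ∀ {X : Set} {P : X → Set} (P? : Decidable P) (key : X → ℕ) {m} (xs : List X) →
                    (∀ {x} → P x → key x < m) → AllPairs (λ x y → P x → P y → key x ≢ key y) xs →
                    length (filter P? xs) ≤ m
filter-keys-bound P? key xs bounded distinct =
  subst (_≤ _) (length-map key (filter P? xs))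
    (unique-bounded (AllPairsₚ.map⁺ (discharge (Allₚ.all-filter P? xs) (AllPairsₚ.filter⁺ P? distinct)))
                    (Allₚ.map⁺ (All.map bounded (Allₚ.all-filter P? xs))))

toList-proj₁ : ∀ {X : Set} {P : X → Set} {xs : List X} (pxs : All P xs) → map proj₁ (All.toList pxs) ≡ xs
toList-proj₁ []         = refl
toList-proj₁ (px ∷ pxs) = cong (_ ∷_) (toList-proj₁ pxs)

module Periodicity {A : Set} {n : ℕ} (T : Fin n → A) where

  -- The letter at position i, or nothing when i is out of range.  Through `at`
  -- letter comparisons become ordinary equations that chain without bound checks.
  at : ℕ → Maybe A
  at i with i <? n
  ... | yes i<n = just (T (fromℕ< i<n))
  ... | no _    = nothing

  at-fromℕ< : ∀ {i} (i<n : i < n) → at i ≡ just (T (fromℕ< i<n))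
  at-fromℕ< {i} i<n with i <? n
  ... | yes _   = refl
  ... | no i≮n = contradiction i<n i≮n

  at-toℕ : (f : Fin n) → at (toℕ f) ≡ just (T f)
  at-toℕ f = trans (at-fromℕ< (toℕ<n f)) (cong (just ∘ T) (fromℕ<-toℕ f (toℕ<n f)))

  letters-agree : ∀ {i j} (i<n : i < n) (j<n : j < n) → at i ≡ at j →
                  T (fromℕ< i<n) ≡ T (fromℕ< j<n)
  letters-agree i<n j<n eq = just-injective (trans (sym (at-fromℕ< i<n)) (trans eq (at-fromℕ< j<n)))

  shifted-index : ∀ {i j p} (i<n : i < n) (j<n : j < n) → j ≡ i + p →
                  toℕ (fromℕ< j<n) ≡ toℕ (fromℕ< i<n) + p
  shifted-index {p = p} i<n j<n j≡i+p =
    trans (toℕ-fromℕ< j<n) (trans j≡i+p (cong (_+ p) (sym (toℕ-fromℕ< i<n))))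

  Periodic : ℕ → ℕ → ℕ → Set
  Periodic a b p = ∀ i → a ≤ i → i + p ≤ b → at i ≡ at (i + p)

  hasPeriod⇒periodic : ∀ {a b p} → b < n → HasPeriod T a b p → Periodic a b p
  hasPeriod⇒periodic {a} {b} {p} b<n per i a≤i i+p≤b = begin
      at i                   ≡⟨ at-fromℕ< i<n ⟩
      just (T (fromℕ< i<n))  ≡⟨ cong just (per (fromℕ< i<n) (fromℕ< j<n) a≤i' j≤b (shifted-index i<n j<n refl)) ⟩
      just (T (fromℕ< j<n))  ≡⟨ sym (at-fromℕ< j<n) ⟩
      at (i + p)             ∎
    where
      open ≡-Reasoning
      j<n : i + p < n
      j<n = ≤-<-trans i+p≤b b<n
      i<n : i < n
      i<n = ≤-<-trans (m≤m+n i p) j<n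
      a≤i' : a ≤ toℕ (fromℕ< i<n)
      a≤i' = subst (a ≤_) (sym (toℕ-fromℕ< i<n)) a≤i
      j≤b : toℕ (fromℕ< j<n) ≤ b
      j≤b = subst (_≤ b) (sym (toℕ-fromℕ< j<n)) i+p≤b

  periodic⇒hasPeriod : ∀ {a b p} → Periodic a b p → HasPeriod T a b p
  periodic⇒hasPeriod {b = b} {p} per fi fj a≤i j≤b j≡i+p = just-injective (begin
      just (T fi)      ≡⟨ sym (at-toℕ fi) ⟩
      at (toℕ fi)      ≡⟨ per (toℕ fi) a≤i (subst (_≤ b) j≡i+p j≤b) ⟩
      at (toℕ fi + p)  ≡⟨ cong at (sym j≡i+p) ⟩
      at (toℕ fj)      ≡⟨ at-toℕ fj ⟩
      just (T fj)      ∎)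
    where open ≡-Reasoning

  run-periodic : ∀ {a b p} → IsRunWithPer T a b p → Periodic a b p
  run-periodic (_ , b<n , (_ , per , _) , _) = hasPeriod⇒periodic b<n per

  run-period≥1 : ∀ {a b p} → IsRunWithPer T a b p → 1 ≤ p
  run-period≥1 (_ , _ , (p≥1 , _) , _) = p≥1

  left-maximal : ∀ {i b p} → IsRunWithPer T (suc i) b p → i + p < n → at i ≢ at (i + p)
  left-maximal {i} (_ , _ , _ , _ , maxˡ , _) j<n eq =
    maxˡ (fromℕ< i<n) (fromℕ< j<n) (cong suc (toℕ-fromℕ< i<n)) (shifted-index i<n j<n refl)
         (letters-agree i<n j<n eq)
    where
      i<n : i < n
      i<n = ≤-<-trans (m≤m+n _ _) j<n

  right-maximal : ∀ {a b p i} → IsRunWithPer T a b p → i + p ≡ suc b → suc b < n →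
                  at i ≢ at (suc b)
  right-maximal {p = p} {i} (_ , _ , _ , _ , _ , maxʳ) i+p≡j j<n eq =
    maxʳ (fromℕ< i<n) (fromℕ< j<n) (toℕ-fromℕ< j<n) (shifted-index i<n j<n (sym i+p≡j))
         (letters-agree i<n j<n eq)
    where
      i<n : i < n
      i<n = ≤-<-trans (subst (i ≤_) i+p≡j (m≤m+n i p)) j<n

  restrict : ∀ {a b c e p} → a ≤ c → e ≤ b → Periodic a b p → Periodic c e p
  restrict a≤c e≤b per i c≤i i+p≤e = per i (≤-trans a≤c c≤i) (≤-trans i+p≤e e≤b)

  -- If T[a..b] has a period q ≥ 1 and a subfragment T[c..e]
  -- of length at least q + d has period d, then d is a period of all of T[a..b]:
  -- stepping by q moves any position into T[c..e] without changing the letters.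
  period-extension : ∀ {a b c e q d} → 1 ≤ q → a ≤ c → e ≤ b → c + q + d ≤ suc e →
                     Periodic a b q → Periodic c e d → Periodic a b d
  period-extension {a} {b} {c} {e} {q} {d} q≥1 a≤c e≤b wide q-per d-per i a≤i i+d≤b =
    downward c i (m≤n+m c i) a≤i i+d≤b
    where
      open ≡-Reasoning

      -- Positions right of c: step down by q until T[i..i+d] lies inside T[c..e].
      upward : ∀ i → c ≤ i → i + d ≤ b → at i ≡ at (i + d)
      upward = <-rec (λ i → c ≤ i → i + d ≤ b → at i ≡ at (i + d)) step
        where
          step : ∀ i → (∀ {j} → j < i → c ≤ j → j + d ≤ b → at j ≡ at (j + d)) →
                 c ≤ i → i + d ≤ b → at i ≡ at (i + d)
          step i rec c≤i i+d≤b with i + d ≤? e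
          ... | yes i+d≤e = d-per i c≤i i+d≤e
          -- T[i..i+d] leaves T[c..e], so i ≥ c + q; step down to j = i - q
          ... | no  i+d≰e = begin
              at i            ≡⟨ cong at (sym j+q≡i) ⟩
              at (j + q)      ≡⟨ sym (q-per j a≤j (subst (_≤ b) (sym j+q≡i) (≤-trans (m≤m+n i d) i+d≤b))) ⟩
              at j            ≡⟨ rec j<i c≤j (≤-trans (+-monoˡ-≤ d (m∸n≤m i q)) i+d≤b) ⟩
              at (j + d)      ≡⟨ q-per (j + d) (≤-trans a≤j (m≤m+n j d)) (subst (_≤ b) (sym j+d+q≡i+d) i+d≤b) ⟩
              at (j + d + q)  ≡⟨ cong at j+d+q≡i+d ⟩
              at (i + d)      ∎
            where
              c+q≤i : c + q ≤ i
              c+q≤i = +-cancelʳ-≤ d (c + q) i (≤-trans wide (≰⇒> i+d≰e))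
              j : ℕ
              j = i ∸ q
              j+q≡i : j + q ≡ i
              j+q≡i = m∸n+n≡m (≤-trans (m≤n+m q c) c+q≤i)
              j<i : j < i
              j<i = ∸-monoʳ-< q≥1 (≤-trans (m≤n+m q c) c+q≤i)
              c≤j : c ≤ j
              c≤j = m+n≤o⇒m≤o∸n c c+q≤i
              a≤j : a ≤ j
              a≤j = ≤-trans a≤c c≤j
              j+d+q≡i+d : j + d + q ≡ i + d
              j+d+q≡i+d = trans (+-right-comm j d q) (cong (_+ d) j+q≡i)

      -- Positions left of c (at distance at most t): step up by q.
      downward : ∀ t i → c ≤ i + t → a ≤ i → i + d ≤ b → at i ≡ at (i + d)
      downward zero i c≤i+0 _ i+d≤b = upward i (subst (c ≤_) (+-identityʳ i) c≤i+0) i+d≤b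
      downward (suc t) i c≤i+1+t a≤i i+d≤b with c ≤? i
      ... | yes c≤i = upward i c≤i i+d≤b
      ... | no  c≰i = begin
          at i            ≡⟨ q-per i a≤i (≤-trans (m≤m+n (i + q) d) i+q+d≤b) ⟩
          at (i + q)      ≡⟨ downward t (i + q) c≤i+q+t (≤-trans a≤i (m≤m+n i q)) i+q+d≤b ⟩
          at (i + q + d)  ≡⟨ cong at (+-right-comm i q d) ⟩
          at (i + d + q)  ≡⟨ sym (q-per (i + d) (≤-trans a≤i (m≤m+n i d))
                                   (subst (_≤ b) (+-right-comm i q d) i+q+d≤b)) ⟩
          at (i + d)      ∎
        where
          i+q+d≤b : i + q + d ≤ b
          i+q+d≤b = ≤-trans (s≤s⁻¹ (≤-trans (+-monoˡ-< d (+-monoˡ-< q (≰⇒> c≰i))) wide)) e≤b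
          c≤i+q+t : c ≤ i + q + t
          c≤i+q+t = ≤-trans c≤i+1+t
            (≤-trans (≤-reflexive (sym (+-assoc i 1 t))) (+-monoˡ-≤ t (+-monoʳ-≤ i q≥1)))

  -- A run has no period p < per(R) on a window of length ≥ per(R) + p:
  -- by period extension p would be a period of the whole run.
  no-smaller-period : ∀ {a b q c e p} → IsRunWithPer T a b q → a ≤ c → e ≤ b →
                      c + q + p ≤ suc e → 1 ≤ p → p < q → Periodic c e p → ⊥
  no-smaller-period R@(_ , _ , (q≥1 , _ , minimal) , _) a≤c e≤b wide p≥1 p<q p-per =
    minimal _ p≥1 p<q (periodic⇒hasPeriod (period-extension q≥1 a≤c e≤b wide (run-periodic R) p-per))

  same-start : ∀ {a₁ b₁ a₂ b₂ p} → IsRunWithPer T a₁ b₁ p → IsRunWithPer T a₂ b₂ p →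
               a₂ + p ≤ suc b₁ → ¬ a₁ < a₂
  same-start {a₂ = suc i} R₁@(_ , b₁<n , _) R₂ i+p≤b₁ (s≤s a₁≤i) =
    left-maximal R₂ (≤-<-trans (s≤s⁻¹ i+p≤b₁) b₁<n) (run-periodic R₁ i a₁≤i (s≤s⁻¹ i+p≤b₁))

  same-end : ∀ {a₁ b₁ a₂ b₂ p} → IsRunWithPer T a₁ b₁ p → IsRunWithPer T a₂ b₂ p →
             a₂ + p ≤ suc b₁ → ¬ b₁ < b₂
  same-end {b₁ = b₁} {a₂} {b₂} {p} R₁ R₂@(_ , b₂<n , _) a₂+p≤b₁+1 b₁<b₂ =
    right-maximal R₁ i+p≡b₁+1 (≤-<-trans b₁<b₂ b₂<n)
      (subst (λ j → at i ≡ at j) i+p≡b₁+1 (run-periodic R₂ i (m+n≤o⇒m≤o∸n a₂ a₂+p≤b₁+1)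
        (subst (_≤ b₂) (sym i+p≡b₁+1) b₁<b₂)))
    where
      i : ℕ
      i = suc b₁ ∸ p
      i+p≡b₁+1 : i + p ≡ suc b₁
      i+p≡b₁+1 = m∸n+n≡m (≤-trans (m≤n+m p a₂) a₂+p≤b₁+1)

  runs-overlap : ∀ {a₁ b₁ p a₂ b₂ q c e} → IsRunWithPer T a₁ b₁ p → IsRunWithPer T a₂ b₂ q →
                 a₁ ≤ c → a₂ ≤ c → e ≤ b₁ → e ≤ b₂ → c + p + q ≤ suc e → (a₁ , b₁) ≡ (a₂ , b₂)
  -- different periods contradict minimality of the larger one; equal periods
  -- force equal endpoints by maximality
  runs-overlap {a₁} {b₁} {p} {a₂} {b₂} {q} {c} {e} R₁ R₂ a₁≤c a₂≤c e≤b₁ e≤b₂ wide with <-cmp p q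
  ... | tri< p<q _ _ = ⊥-elim (no-smaller-period R₂ a₂≤c e≤b₂ (subst (_≤ suc e) (+-right-comm c p q) wide)
                                 (run-period≥1 R₁) p<q (restrict a₁≤c e≤b₁ (run-periodic R₁)))
  ... | tri> _ _ q<p = ⊥-elim (no-smaller-period R₁ a₁≤c e≤b₁ wide
                                 (run-period≥1 R₂) q<p (restrict a₂≤c e≤b₂ (run-periodic R₂)))
  ... | tri≈ _ refl _ with <-cmp a₁ a₂ | <-cmp b₁ b₂
  ...   | tri< a₁<a₂ _ _ | _              = contradiction a₁<a₂ (same-start R₁ R₂ (window-reach a₂≤c e≤b₁ wide))
  ...   | tri> _ _ a₂<a₁ | _              = contradiction a₂<a₁ (same-start R₂ R₁ (window-reach a₁≤c e≤b₂ wide))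
  ...   | tri≈ _ _ _     | tri< b₁<b₂ _ _ = contradiction b₁<b₂ (same-end R₁ R₂ (window-reach a₂≤c e≤b₁ wide))
  ...   | tri≈ _ _ _     | tri> _ _ b₂<b₁ = contradiction b₂<b₁ (same-end R₂ R₁ (window-reach a₁≤c e≤b₂ wide))
  ...   | tri≈ _ refl _  | tri≈ _ refl _  = refl

module Cores {A : Set} {n : ℕ} (T : Fin n → A) where
  open Periodicity T

  HPRun : Set
  HPRun = Σ (ℕ × ℕ) (IsHPRun T)

  period : HPRun → ℕ
  period (_ , p , _) = p

  scale : HPRun → ℕ
  scale R = ⌊log₂ period R ⌋

  InCore : ℕ → HPRun → Set
  InCore x ((a , b) , p , _) = (a + p ≤ x) × (x + p ≤ b)

  inCore? : ∀ x → Decidable (InCore x)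
  inCore? x ((a , b) , p , _) = (a + p ≤? x) ×-dec (x + p ≤? b)

  coreSize : HPRun → ℕ
  coreSize R = sumBelow n (λ x → indicator (inCore? x R))

  hp-span : ∀ {a b p} → IsRunWithPer T a b p → 4 * p ≤ fragLen (a , b) → a + 4 * p ≤ suc b
  hp-span {a} {b} {p} (a≤b , _) 4p≤len =
    subst (_≤ suc b) (+-comm (4 * p) a) (m≤o∸n⇒m+n≤o (4 * p) (≤-trans a≤b (n≤1+n b)) 4p≤len)

  period≤n : (R : HPRun) → period R ≤ n
  period≤n ((a , b) , p , run@(_ , b<n , _) , 4p≤len) =
    ≤-trans (m≤n*m p 4) (≤-trans (m≤n+m (4 * p) a) (≤-trans (hp-span run 4p≤len) b<n))

  -- The core covers at least half of the run: |R| - 2 per(R) ≥ |R| / 2.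
  core-size : (R : HPRun) → fragLen (proj₁ R) ≤ 2 * coreSize R
  core-size R@((a , b) , p , (a≤b , b<n , _) , 4p≤len) with m≤n⇒∃[o]m+o≡n 4p≤len
  ... | s , 4p+s≡len = begin
      suc b ∸ a          ≡⟨ sym 4p+s≡len ⟩
      4 * p + s          ≤⟨ m≤m+n (4 * p + s) s ⟩
      4 * p + s + s      ≡⟨ doubling p s ⟩
      2 * (2 * p + s)    ≤⟨ *-monoʳ-≤ 2 (sumBelow-ones n (a + p) (2 * p + s)
                              (≤-trans (m≤m+n _ p) (≤-trans (≤-reflexive end≡) b<n)) in-core) ⟩
      2 * coreSize R     ∎
    where
      open ≤-Reasoning
      doubling : ∀ p s → 4 * p + s + s ≡ 2 * (2 * p + s)
      doubling = solve-∀
      end≡ : a + p + (2 * p + s) + p ≡ suc b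
      end≡ = trans (regroup a p s) (trans (cong (a +_) 4p+s≡len) (m+[n∸m]≡n (≤-trans a≤b (n≤1+n b))))
        where
          regroup : ∀ a p s → a + p + (2 * p + s) + p ≡ a + (4 * p + s)
          regroup = solve-∀
      -- the core is the interval a + p, …, a + p + (2p + s) - 1
      in-core : ∀ u → u < 2 * p + s → 1 ≤ indicator (inCore? (a + p + u) R)
      in-core u u<t = indicator-yes (inCore? (a + p + u) R)
        (m≤m+n (a + p) u , s≤s⁻¹ (≤-trans (+-monoˡ-< p (+-monoʳ-< (a + p) u<t)) (≤-reflexive end≡)))

  ordered-core-overlap : ∀ {a₁ b₁ p a₂ b₂ q x} → IsRunWithPer T a₁ b₁ p → IsRunWithPer T a₂ b₂ q →
                         a₂ + 4 * q ≤ suc b₂ → a₂ + q ≤ x → x + p ≤ b₁ → p < 2 * q → a₁ ≤ a₂ →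
                         (a₁ , b₁) ≡ (a₂ , b₂)
  ordered-core-overlap {a₁} {b₁} {p} {a₂} {b₂} {q} R₁ R₂ span₂ a₂+q≤x x+p≤b₁ p<2q a₁≤a₂ with ≤-total b₁ b₂
  ... | inj₁ b₁≤b₂ = runs-overlap R₁ R₂ a₁≤a₂ ≤-refl ≤-refl b₁≤b₂
        (subst (_≤ suc b₁) (+-right-comm a₂ q p) (≤-trans (+-monoˡ-≤ p a₂+q≤x) (≤-trans x+p≤b₁ (n≤1+n b₁))))
  ... | inj₂ b₂≤b₁ = runs-overlap R₁ R₂ a₁≤a₂ ≤-refl b₂≤b₁ ≤-refl
        (≤-trans (subst (_≤ a₂ + 4 * q) (sym (+-assoc a₂ p q)) (+-monoʳ-≤ a₂ p+q≤4q)) span₂)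
    where
      four : ∀ q → 4 * q ≡ 2 * q + q + q
      four = solve-∀
      p+q≤4q : p + q ≤ 4 * q
      p+q≤4q = ≤-trans (+-monoˡ-≤ q (<⇒≤ p<2q)) (subst (2 * q + q ≤_) (sym (four q)) (m≤m+n (2 * q + q) q))

  core-run-unique : ∀ x (R₁ R₂ : HPRun) → InCore x R₁ → InCore x R₂ → scale R₁ ≡ scale R₂ →
                    proj₁ R₁ ≡ proj₁ R₂
  core-run-unique x ((a₁ , b₁) , p , run₁ , hp₁) ((a₂ , b₂) , q , run₂ , hp₂)
                  (a₁+p≤x , x+p≤b₁) (a₂+q≤x , x+q≤b₂) same with ≤-total a₁ a₂
  ... | inj₁ a₁≤a₂ = ordered-core-overlap run₁ run₂ (hp-span run₂ hp₂) a₂+q≤x x+p≤b₁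
                       (same-scale-close (run-period≥1 run₂) (sym same)) a₁≤a₂
  ... | inj₂ a₂≤a₁ = sym (ordered-core-overlap run₂ run₁ (hp-span run₁ hp₁) a₁+p≤x x+q≤b₂
                       (same-scale-close (run-period≥1 run₁) same) a₂≤a₁)

  runs-through-position : ∀ x (Rs : List HPRun) → AllPairs (λ R₁ R₂ → proj₁ R₁ ≢ proj₁ R₂) Rs →
                          length (filter (inCore? x) Rs) ≤ suc ⌊log₂ n ⌋
  runs-through-position x Rs distinct =
    filter-keys-bound (inCore? x) scale Rs (λ {R} _ → s≤s (⌊log₂⌋-mono-≤ (period≤n R)))
      (AllPairs.map (λ {R₁} {R₂} different in₁ in₂ same → different (core-run-unique x R₁ R₂ in₁ in₂ same)) distinct)

  -- Each run is at most twice its core, and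
  -- summing the cores position by position gives at most ⌊log₂ n⌋ + 1 per position.
  hp-runs-bound : (rs : List (ℕ × ℕ)) → Unique rs → All (IsHPRun T) rs →
                  sum (map fragLen rs) ≤ 2 * (n * suc ⌊log₂ n ⌋)
  hp-runs-bound rs unique certs = begin
      sum (map fragLen rs)                                   ≡⟨ cong (sum ∘ map fragLen) (sym (toList-proj₁ certs)) ⟩
      sum (map fragLen (map proj₁ Rs))                       ≡⟨ cong sum (sym (map-∘ Rs)) ⟩
      sum (map (fragLen ∘ proj₁) Rs)                         ≤⟨ sum-map-mono Rs core-size ⟩
      sum (map (λ R → 2 * coreSize R) Rs)                    ≡⟨ sum-map-scale Rs 2 coreSize ⟩
      2 * sum (map coreSize Rs)                              ≡⟨ cong (2 *_) (double-counting inCore? n Rs) ⟩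
      2 * sumBelow n (λ x → length (filter (inCore? x) Rs))  ≤⟨ *-monoʳ-≤ 2 (sumBelow-mono n (λ x → runs-through-position x Rs distinct)) ⟩
      2 * sumBelow n (λ _ → suc ⌊log₂ n ⌋)                   ≡⟨ cong (2 *_) (sumBelow-const n (suc ⌊log₂ n ⌋)) ⟩
      2 * (n * suc ⌊log₂ n ⌋)                                ∎
    where
      open ≤-Reasoning
      Rs : List HPRun
      Rs = All.toList certs
      distinct : AllPairs (λ R₁ R₂ → proj₁ R₁ ≢ proj₁ R₂) Rs
      distinct = AllPairsₚ.map⁻ (subst Unique (sym (toList-proj₁ certs)) unique)

fact6p2 : ∃[ C ] ∃[ N ] ((A : Set) (n : ℕ) (T : Fin n → A) (rs : List (ℕ × ℕ)) →
            Unique rs → ((r : ℕ × ℕ) → (r ∈ rs → IsHPRun T r) × (IsHPRun T r → r ∈ rs)) →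
            N ≤ n → sum (map fragLen rs) ≤ C * n * ⌊log₂ n ⌋)
fact6p2 = 4 , 2 , λ A n T rs unique spec 2≤n →
  ≤-trans (Cores.hp-runs-bound T rs unique (All.tabulate (λ {r} r∈rs → proj₁ (spec r) r∈rs)))
          (n-log-n-bound n 2≤n)
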